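{- Let $m\equiv 1\pmod 4$, $m\geq 5$, and let $M$ be an induced matching of the grid $G_{3,m}$. Suppose that for some $j$ with $1\leq j$ and $j+2\leq m$, both the edge joining $u_1v_j$ and $u_2v_j$ and the edge joining $u_1v_{j+2}$ and $u_2v_{j+2}$ belong to $M$. Then $|M|\neq \mathrm{Max}(G_{3,m})$.
   Context: For integers $n,m\geq 2$, the grid $G_{n,m}$ is the Cartesian product of the path $P_n=u_1u_2\cdots u_n$ and the path $P_m=v_1v_2\cdots v_m$; its vertices are written $u_iv_j$ ($1\le i\le n$, $1\le j\le m$), and $u_iv_j$, $u_kv_l$ are adjacent iff either $i=k$ and $|j-l|=1$, or $j=l$ and $|i-k|=1$. An induced matching of a graph $G$ is a set $M$ of pairwise vertex-disjoint edges such that no edge of $G$ joins endpoints of two distinct edges of $M$. $\mathrm{Max}(G)$ denotes the maximum size of an induced matching of $G$. -}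

module Defs where

open import Data.Nat using (ℕ; zero; suc; _+_; _≤_)
open import Data.Fin using (Fin; toℕ)
open import Data.Product using (_×_; _,_; proj₁; proj₂; ∃)
open import Data.Sum using (_⊎_)
open import Data.List using (List; length; lookup)
open import Relation.Binary.PropositionalEquality using (_≡_)
open import Relation.Nullary using (¬_)

-- Vertex u_i v_j of G_{n,m} is (i-1 , j-1) : Fin n × Fin m  (0-indexed).
Vertex : ℕ → ℕ → Set
Vertex n m = Fin n × Fin m

Next : ℕ → ℕ → Set
Next a b = suc a ≡ b ⊎ suc b ≡ a

Adj : ∀ {n m} → Vertex n m → Vertex n m → Set
Adj (i , j) (k , l) = (i ≡ k × Next (toℕ j) (toℕ l)) ⊎ (j ≡ l × Next (toℕ i) (toℕ k))

Edge : ℕ → ℕ → Set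
Edge n m = Vertex n m × Vertex n m

Separated : ∀ {n m} → Edge n m → Edge n m → Set
Separated {n} {m} (a , b) (c , d) =
  ∀ (x y : Vertex n m) → (x ≡ a ⊎ x ≡ b) → (y ≡ c ⊎ y ≡ d) →
    ¬ (x ≡ y) × ¬ Adj x y

-- An induced matching of G_{n,m}, listed without repetition: every listed
-- pair is an edge of the grid, and any two entries at distinct positions
-- are separated (this forces pairwise distinct edges, so |M| = length M).
record InducedMatching (n m : ℕ) : Set where
  field
    edges    : List (Edge n m)
    isEdge   : ∀ p → Adj (proj₁ (lookup edges p)) (proj₂ (lookup edges p))
    induced  : ∀ p q → ¬ (p ≡ q) → Separated (lookup edges p) (lookup edges q)

open InducedMatching public

size : ∀ {n m} → InducedMatching n m → ℕ
size M = length (edges M)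

_∈M_ : ∀ {n m} → Vertex n m × Vertex n m → InducedMatching n m → Set
(x , y) ∈M M = ∃ λ p → lookup (edges M) p ≡ (x , y) ⊎ lookup (edges M) p ≡ (y , x)

IsMax : ℕ → ℕ → ℕ → Set
IsMax n m k = (∃ λ (M : InducedMatching n m) → size M ≡ k)
            × (∀ (M : InducedMatching n m) → size M ≤ k)

module Submission where

-- Lower bound: for m = 4k + 5, k blocks of three edges (u₁ and u₃ across two columns, then u₂
-- across the next two) followed by four edges on the last five columns form an induced
-- matching of size 3k + 4.
--
-- Upper bound: record which vertices of each column M saturates. In an induced matching every
-- saturated vertex has exactly one saturated neighbour, a condition on three consecutive
-- columns. A potential ψ on pairs of consecutive columns, checked over all 8³ column triples,
-- shows that a column carries at most 3/2 saturated vertices on amortised average, whence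
-- 4|M| ≤ 3m + 2. A second potential φ with the same property is at least 3 everywhere, and the
-- two vertical edges u₁v_j u₂v_j and u₁v_{j+2} u₂v_{j+2} are exactly what is needed to pass
-- from ψ to φ at column j + 1. Hence 4|M| ≤ 3m − 1 < 4 (3k + 4).

open import Defs
open import Data.Bool using (Bool; true; false; _∧_; _∨_; not; if_then_else_)
open import Data.Bool.ListAction using (or)
open import Data.Bool.Properties using () renaming (_≟_ to _≟ᵇ_)
open import Data.Empty using (⊥-elim)
open import Data.Fin using (Fin; toℕ; zero; suc)
import Data.Fin.Properties as Fin
open import Data.Fin.Properties using (toℕ-injective; toℕ<n) renaming (_≟_ to _≟ᶠ_)
open import Data.List using (List; []; _∷_; _++_; length; lookup; map)
open import Data.List.Membership.Propositional using (_∈_)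
open import Data.List.Membership.Propositional.Properties using (∈-lookup; ∈-map⁺; ∈-map⁻)
open import Data.List.Properties using (tabulate-lookup; length-map)
open import Data.List.Relation.Unary.All using (All; []; _∷_)
import Data.List.Relation.Unary.All as All
import Data.List.Relation.Unary.All.Properties as Allₚ
open import Data.List.Relation.Unary.AllPairs using (AllPairs; []; _∷_; allPairs?)
import Data.List.Relation.Unary.AllPairs as AllPairs
import Data.List.Relation.Unary.AllPairs.Properties as AllPairsₚ
open import Data.List.Relation.Unary.Any using (Any; here; there; index)
open import Data.List.Relation.Unary.Any.Properties using (lookup-index)
open import Data.List.Relation.Unary.Unique.Propositional using (Unique)
open import Data.List.Relation.Unary.Unique.Propositional.Properties using (Unique[x∷xs]⇒x∉xs)
open import Data.Nat using (ℕ; zero; suc; _+_; _*_; _≤_; _<_; _≤?_; _%_; _/_; s≤s)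
open import Data.Nat.DivMod using (m≡m%n+[m/n]*n)
open import Data.Nat.Properties
  using ( _≟_; suc-injective; ≤-refl; ≤-reflexive; ≤-trans; <⇒≤; <⇒≢; <⇒≱; 1+n≰n; n≮n; <-cmp
        ; n≤1+n; m≤m+n; m<n⇒m<1+n; m<1+n⇒m<n∨m≡n; +-comm; +-assoc; +-identityʳ; +-monoʳ-≤
        ; +-monoˡ-≤; *-monoʳ-≤; *-zeroʳ; *-suc; *-distribˡ-+; module ≤-Reasoning)
open import Data.Nat.Tactic.RingSolver using (solve-∀)
open import Data.Product using (_×_; _,_; proj₁; proj₂; ∃)
open import Data.Product.Properties using (≡-dec)
open import Data.Sum using (_⊎_; inj₁; inj₂)
import Data.Sum as Sum
open import Function using (_∘_; case_of_)
open import Relation.Binary.Definitions using (DecidableEquality; tri<; tri≈; tri>)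
open import Relation.Binary.PropositionalEquality
open import Relation.Nullary using (¬_; yes; no)
open import Relation.Nullary.Decidable
  using (Dec; does; map′; ¬?; _×-dec_; _⊎-dec_; _→-dec_; from-yes; dec-true; dec-false)

private variable
  n m : ℕ

AllPairs-lookup : ∀ {A : Set} {R : A → A → Set} {xs : List A} → (∀ {x y} → R x y → R y x) →
                  AllPairs R xs → ∀ p q → ¬ p ≡ q → R (lookup xs p) (lookup xs q)
AllPairs-lookup sym-R (_ ∷ _)       zero    zero    p≢q = ⊥-elim (p≢q refl)
AllPairs-lookup sym-R (Rx ∷ _)      zero    (suc q) _   = All.lookup Rx (∈-lookup q)
AllPairs-lookup sym-R (Rx ∷ _)      (suc p) zero    _   = sym-R (All.lookup Rx (∈-lookup p))
AllPairs-lookup sym-R (_ ∷ R-pairs) (suc p) (suc q) p≢q =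
  AllPairs-lookup sym-R R-pairs p q (p≢q ∘ cong suc)

exactlyOne : List Bool → Bool
exactlyOne []       = false
exactlyOne (b ∷ bs) = if b then not (or bs) else exactlyOne bs

or-map-false : ∀ {A : Set} (f : A → Bool) {xs} → (∀ {y} → y ∈ xs → ¬ f y ≡ true) →
               or (map f xs) ≡ false
or-map-false f {[]}     none = refl
or-map-false f {x ∷ xs} none with f x in fx
... | true  = ⊥-elim (none (here refl) fx)
... | false = or-map-false f (none ∘ there)

exactlyOne-map : ∀ {A : Set} (f : A → Bool) {xs x} → Unique xs → x ∈ xs → f x ≡ true →
                 (∀ {y} → y ∈ xs → f y ≡ true → y ≡ x) → exactlyOne (map f xs) ≡ true
exactlyOne-map f {y ∷ ys} (y∉ys ∷ unique) (here refl) fx only with f y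
... | true = cong not (or-map-false f λ z∈ys fz → All.lookup y∉ys z∈ys (sym (only (there z∈ys) fz)))
exactlyOne-map f {y ∷ ys} (y∉ys ∷ unique) (there x∈ys) fx only with f y in fy
... | true  = ⊥-elim (All.lookup y∉ys x∈ys (only (here refl) fy))
... | false = exactlyOne-map f unique x∈ys fx (only ∘ there)

⟦_⟧ : Bool → ℕ
⟦ true  ⟧ = 1
⟦ false ⟧ = 0

∑< : ℕ → (ℕ → ℕ) → ℕ
∑< zero    f = 0
∑< (suc n) f = ∑< n f + f n

∑<-cong : ∀ n {f g : ℕ → ℕ} → (∀ t → f t ≡ g t) → ∑< n f ≡ ∑< n g
∑<-cong zero    f≗g = refl
∑<-cong (suc n) f≗g = cong₂ _+_ (∑<-cong n f≗g) (f≗g n)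

∑<-zero : ∀ n → ∑< n (λ _ → 0) ≡ 0
∑<-zero zero    = refl
∑<-zero (suc n) = cong (_+ 0) (∑<-zero n)

∑<-+ : ∀ n (f g : ℕ → ℕ) → ∑< n (λ t → f t + g t) ≡ ∑< n f + ∑< n g
∑<-+ zero    f g = refl
∑<-+ (suc n) f g = begin
  ∑< n (λ t → f t + g t) + (f n + g n)  ≡⟨ cong (_+ (f n + g n)) (∑<-+ n f g) ⟩
  ∑< n f + ∑< n g + (f n + g n)         ≡⟨ +-interchange (∑< n f) (∑< n g) (f n) (g n) ⟩
  ∑< n f + f n + (∑< n g + g n)         ∎
  where
  open ≡-Reasoning
  +-interchange : ∀ a b c d → a + b + (c + d) ≡ a + c + (b + d)
  +-interchange = solve-∀

∑<-*ˡ : ∀ n k (f : ℕ → ℕ) → ∑< n (λ t → k * f t) ≡ k * ∑< n f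
∑<-*ˡ zero    k f = sym (*-zeroʳ k)
∑<-*ˡ (suc n) k f = trans (cong (_+ k * f n) (∑<-*ˡ n k f)) (sym (*-distribˡ-+ k (∑< n f) (f n)))

∑<-indicator-≥ : ∀ {n c} → n ≤ c → ∑< n (λ t → ⟦ does (t ≟ c) ⟧) ≡ 0
∑<-indicator-≥ {zero}  _   = refl
∑<-indicator-≥ {suc n} n<c =
  cong₂ _+_ (∑<-indicator-≥ (<⇒≤ n<c)) (cong ⟦_⟧ (dec-false (n ≟ _) (<⇒≢ n<c)))

∑<-indicator : ∀ {n c} → c < n → ∑< n (λ t → ⟦ does (t ≟ c) ⟧) ≡ 1
∑<-indicator {suc n} c<1+n with m<1+n⇒m<n∨m≡n c<1+n
... | inj₁ c<n  = cong₂ _+_ (∑<-indicator c<n) (cong ⟦_⟧ (dec-false (n ≟ _) (≢-sym (<⇒≢ c<n))))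
... | inj₂ refl = cong₂ _+_ (∑<-indicator-≥ {n} ≤-refl) (cong ⟦_⟧ (dec-true (n ≟ n) refl))

∑<-telescope : ∀ {c} (f Q : ℕ → ℕ) → (∀ t → f t + Q (suc t) ≤ c + Q t) →
               ∀ n → ∑< n f + Q n ≤ n * c + Q 0
∑<-telescope     f Q step zero    = ≤-refl
∑<-telescope {c} f Q step (suc n) = begin
  ∑< n f + f n + Q (suc n)   ≡⟨ +-assoc (∑< n f) (f n) (Q (suc n)) ⟩
  ∑< n f + (f n + Q (suc n)) ≤⟨ +-monoʳ-≤ (∑< n f) (step n) ⟩
  ∑< n f + (c + Q n)         ≡⟨ +-shuffle (∑< n f) c (Q n) ⟩
  c + (∑< n f + Q n)         ≤⟨ +-monoʳ-≤ c (∑<-telescope f Q step n) ⟩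
  c + (n * c + Q 0)          ≡⟨ +-assoc c (n * c) (Q 0) ⟨
  suc n * c + Q 0            ∎
  where
  open ≤-Reasoning
  +-shuffle : ∀ a b d → a + (b + d) ≡ b + (a + d)
  +-shuffle = solve-∀

Next-sym : ∀ {a b} → Next a b → Next b a
Next-sym (inj₁ e) = inj₂ e
Next-sym (inj₂ e) = inj₁ e

Next-irrefl : ∀ {a} → ¬ Next a a
Next-irrefl (inj₁ ())
Next-irrefl (inj₂ ())

next? : ∀ a b → Dec (Next a b)
next? a b = (suc a ≟ b) ⊎-dec (suc b ≟ a)

Adj-sym : {x y : Vertex n m} → Adj x y → Adj y x
Adj-sym (inj₁ (e , d)) = inj₁ (sym e , Next-sym d)
Adj-sym (inj₂ (e , d)) = inj₂ (sym e , Next-sym d)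

Adj-irrefl : {x : Vertex n m} → ¬ Adj x x
Adj-irrefl (inj₁ (_ , d)) = Next-irrefl d
Adj-irrefl (inj₂ (_ , d)) = Next-irrefl d

adj? : (x y : Vertex n m) → Dec (Adj x y)
adj? (i , j) (k , l) =
  (i ≟ᶠ k ×-dec next? (toℕ j) (toℕ l)) ⊎-dec (j ≟ᶠ l ×-dec next? (toℕ i) (toℕ k))

Apart : Vertex n m → Vertex n m → Set
Apart x y = ¬ x ≡ y × ¬ Adj x y

Apart-sym : {x y : Vertex n m} → Apart x y → Apart y x
Apart-sym (x≢y , ¬xy) = ≢-sym x≢y , ¬xy ∘ Adj-sym

apart? : (x y : Vertex n m) → Dec (Apart x y)
apart? x y = ¬? (≡-dec _≟ᶠ_ _≟ᶠ_ x y) ×-dec ¬? (adj? x y)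

near-column : {x y : Vertex n m} → x ≡ y ⊎ Adj x y → toℕ (proj₂ y) ≤ suc (toℕ (proj₂ x))
near-column (inj₁ refl)                = n≤1+n _
near-column (inj₂ (inj₁ (_ , inj₁ e))) = ≤-reflexive (sym e)
near-column (inj₂ (inj₁ (_ , inj₂ e))) = ≤-trans (n≤1+n _) (≤-trans (≤-reflexive e) (n≤1+n _))
near-column (inj₂ (inj₂ (refl , _)))   = n≤1+n _

apart-far : {x y : Vertex n m} → suc (toℕ (proj₂ x)) < toℕ (proj₂ y) → Apart x y
apart-far far = (<⇒≱ far ∘ near-column ∘ inj₁) , (<⇒≱ far ∘ near-column ∘ inj₂)

Endpoint : Vertex n m → Edge n m → Set
Endpoint v e = v ≡ proj₁ e ⊎ v ≡ proj₂ e

endpoint? : (v : Vertex n m) (e : Edge n m) → Dec (Endpoint v e)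
endpoint? v (a , b) = ≡-dec _≟ᶠ_ _≟ᶠ_ v a ⊎-dec ≡-dec _≟ᶠ_ _≟ᶠ_ v b

IsEdge : Edge n m → Set
IsEdge (a , b) = Adj a b

Separated-sym : {e f : Edge n m} → Separated e f → Separated f e
Separated-sym sep x y x∈f y∈e = Apart-sym (sep y x y∈e x∈f)

separated : ∀ {a b c d : Vertex n m} → Apart a c → Apart a d → Apart b c → Apart b d →
            Separated (a , b) (c , d)
separated ac ad bc bd _ _ (inj₁ refl) (inj₁ refl) = ac
separated ac ad bc bd _ _ (inj₁ refl) (inj₂ refl) = ad
separated ac ad bc bd _ _ (inj₂ refl) (inj₁ refl) = bc
separated ac ad bc bd _ _ (inj₂ refl) (inj₂ refl) = bd

separated⁻ : ∀ {a b c d : Vertex n m} → Separated (a , b) (c , d) →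
             Apart a c × Apart a d × Apart b c × Apart b d
separated⁻ {a = a} {b} {c} {d} sep =
  sep a c (inj₁ refl) (inj₁ refl) , sep a d (inj₁ refl) (inj₂ refl) ,
  sep b c (inj₂ refl) (inj₁ refl) , sep b d (inj₂ refl) (inj₂ refl)

separated? : (e f : Edge n m) → Dec (Separated e f)
separated? (a , b) (c , d) =
  map′ (λ (ac , ad , bc , bd) → separated ac ad bc bd) separated⁻
       (apart? a c ×-dec apart? a d ×-dec apart? b c ×-dec apart? b d)

shiftᵛ : Vertex n m → Vertex n (suc m)
shiftᵛ (i , j) = i , suc j

shiftᵉ : Edge n m → Edge n (suc m)
shiftᵉ (a , b) = shiftᵛ a , shiftᵛ b

shiftᵛ-injective : {x y : Vertex n m} → shiftᵛ x ≡ shiftᵛ y → x ≡ y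
shiftᵛ-injective e = cong₂ _,_ (cong proj₁ e) (Fin.suc-injective (cong proj₂ e))

Adj-shift : {x y : Vertex n m} → Adj x y → Adj (shiftᵛ x) (shiftᵛ y)
Adj-shift (inj₁ (i≡k , d)) = inj₁ (i≡k , Sum.map (cong suc) (cong suc) d)
Adj-shift (inj₂ (j≡l , d)) = inj₂ (cong suc j≡l , d)

Adj-shift⁻ : {x y : Vertex n m} → Adj (shiftᵛ x) (shiftᵛ y) → Adj x y
Adj-shift⁻ (inj₁ (i≡k , d)) = inj₁ (i≡k , Sum.map suc-injective suc-injective d)
Adj-shift⁻ (inj₂ (e , d))   = inj₂ (Fin.suc-injective e , d)

Apart-shift : {x y : Vertex n m} → Apart x y → Apart (shiftᵛ x) (shiftᵛ y)
Apart-shift (x≢y , ¬xy) = x≢y ∘ shiftᵛ-injective , ¬xy ∘ Adj-shift⁻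

Separated-shift : {e f : Edge n m} → Separated e f → Separated (shiftᵉ e) (shiftᵉ f)
Separated-shift sep with separated⁻ sep
... | ac , ad , bc , bd = separated (Apart-shift ac) (Apart-shift ad) (Apart-shift bc) (Apart-shift bd)

endpoints : List (Edge n m) → List (Vertex n m)
endpoints []             = []
endpoints ((a , b) ∷ es) = a ∷ b ∷ endpoints es

length-endpoints : (es : List (Edge n m)) → length (endpoints es) ≡ 2 * length es
length-endpoints []       = refl
length-endpoints (_ ∷ es) = trans (cong (2 +_) (length-endpoints es)) (sym (*-suc 2 (length es)))

∈-endpoints⁺ : ∀ {v e} {es : List (Edge n m)} → e ∈ es → Endpoint v e → v ∈ endpoints es
∈-endpoints⁺ {es = _ ∷ _} (here refl) (inj₁ refl) = here refl
∈-endpoints⁺ {es = _ ∷ _} (here refl) (inj₂ refl) = there (here refl)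
∈-endpoints⁺ {es = _ ∷ _} (there e∈)  v∈e         = there (there (∈-endpoints⁺ e∈ v∈e))

∈-endpoints⁻ : ∀ {v} (es : List (Edge n m)) → v ∈ endpoints es → Any (Endpoint v) es
∈-endpoints⁻ (_ ∷ _)  (here refl)         = here (inj₁ refl)
∈-endpoints⁻ (_ ∷ _)  (there (here refl)) = here (inj₂ refl)
∈-endpoints⁻ (_ ∷ es) (there (there v∈))  = there (∈-endpoints⁻ es v∈)

separated-endpoints : ∀ {x} {e : Edge n m} {es} → All (Separated e) es → Endpoint x e →
                      All (λ y → ¬ x ≡ y) (endpoints es)
separated-endpoints {es = []}          []       x∈e = []
separated-endpoints {es = (c , d) ∷ _} (s ∷ ss) x∈e =
  proj₁ (s _ _ x∈e (inj₁ refl)) ∷ proj₁ (s _ _ x∈e (inj₂ refl)) ∷ separated-endpoints ss x∈e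

endpoints-unique : {es : List (Edge n m)} → All IsEdge es → AllPairs Separated es →
                   Unique (endpoints es)
endpoints-unique {es = []}           []          []           = []
endpoints-unique {es = (a , b) ∷ es} (ab ∷ edge) (sep ∷ sep′) =
  (a≢b ∷ separated-endpoints sep (inj₁ refl)) ∷ separated-endpoints sep (inj₂ refl)
  ∷ endpoints-unique edge sep′
  where
  a≢b : ¬ a ≡ b
  a≢b refl = Adj-irrefl ab

fromList : (es : List (Edge n m)) → All IsEdge es → AllPairs Separated es → InducedMatching n m
fromList es edge sep = record
  { edges   = es
  ; isEdge  = λ p → All.lookup edge (∈-lookup p)
  ; induced = AllPairs-lookup Separated-sym sep
  }

module _ (M : InducedMatching n m) where

  private
    L = edges M

  endpoints-edges-unique : Unique (endpoints L)
  endpoints-edges-unique = subst (Unique ∘ endpoints) (tabulate-lookup L)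
    (endpoints-unique (Allₚ.tabulate⁺ (isEdge M)) (AllPairsₚ.tabulate⁺ (induced M _ _)))

  Saturated : Vertex n m → Set
  Saturated v = v ∈ endpoints L

  ∈M-endpoint : ∀ {u w k} → lookup L k ≡ (u , w) ⊎ lookup L k ≡ (w , u) → Endpoint u (lookup L k)
  ∈M-endpoint (inj₁ e) = inj₁ (cong proj₁ (sym e))
  ∈M-endpoint (inj₂ e) = inj₂ (cong proj₂ (sym e))

  ∈M-sym : ∀ {u w} → (u , w) ∈M M → (w , u) ∈M M
  ∈M-sym (k , inj₁ e) = k , inj₂ e
  ∈M-sym (k , inj₂ e) = k , inj₁ e

  ∈M⇒Adj : ∀ {u w} → (u , w) ∈M M → Adj u w
  ∈M⇒Adj (k , inj₁ e) = subst IsEdge e (isEdge M k)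
  ∈M⇒Adj (k , inj₂ e) = Adj-sym (subst IsEdge e (isEdge M k))

  ∈M⇒saturated : ∀ {u w} → (u , w) ∈M M → Saturated u
  ∈M⇒saturated (k , e) = ∈-endpoints⁺ (∈-lookup k) (∈M-endpoint e)

  saturated⇒∈M : ∀ {u} → Saturated u → ∃ λ w → (u , w) ∈M M
  saturated⇒∈M {u} u∈ = partner (lookup-index u∈e)
    where
    u∈e = ∈-endpoints⁻ L u∈
    k   = index u∈e
    partner : Endpoint u (lookup L k) → ∃ λ w → (u , w) ∈M M
    partner (inj₁ u≡) = proj₂ (lookup L k) , k , inj₁ (cong (_, proj₂ (lookup L k)) (sym u≡))
    partner (inj₂ u≡) = proj₁ (lookup L k) , k , inj₂ (cong (proj₁ (lookup L k) ,_) (sym u≡))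

  saturated-neighbour-is-partner : ∀ {u v w} → (u , w) ∈M M → Saturated v → Adj u v → v ≡ w
  saturated-neighbour-is-partner {u} {v} (k , e) v∈ uv with ∈-endpoints⁻ L v∈
  ... | v∈e with k ≟ᶠ index v∈e
  ...   | no k≢l =
          ⊥-elim (proj₂ (induced M k (index v∈e) k≢l u v (∈M-endpoint e) (lookup-index v∈e)) uv)
  ...   | yes refl with e | lookup-index v∈e
  ...     | inj₁ e′ | inj₁ v≡ = ⊥-elim (Adj-irrefl (subst (Adj u) (trans v≡ (cong proj₁ e′)) uv))
  ...     | inj₁ e′ | inj₂ v≡ = trans v≡ (cong proj₂ e′)
  ...     | inj₂ e′ | inj₁ v≡ = trans v≡ (cong proj₁ e′)
  ...     | inj₂ e′ | inj₂ v≡ = ⊥-elim (Adj-irrefl (subst (Adj u) (trans v≡ (cong proj₂ e′)) uv))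

-- * Saturation patterns of the columns of G_{3,m}

-- Cell (i , t) is vertex (i , t − 1): column 0 and the columns beyond m are empty padding.
Cell : Set
Cell = Fin 3 × ℕ

_≟ᶜ_ : DecidableEquality Cell
_≟ᶜ_ = ≡-dec _≟ᶠ_ _≟_

open import Data.List.Membership.DecPropositional _≟ᶜ_ using (_∈?_)

cell : Vertex 3 m → Cell
cell (i , j) = i , suc (toℕ j)

cell-injective : {u v : Vertex 3 m} → cell u ≡ cell v → u ≡ v
cell-injective e = cong₂ _,_ (cong proj₁ e) (toℕ-injective (suc-injective (cong proj₂ e)))

column : (Cell → ℕ) → ℕ → ℕ
column f t = f (zero , t) + (f (suc zero , t) + f (suc (suc zero) , t))

∑cells : ℕ → (Cell → ℕ) → ℕ
∑cells m f = ∑< m (λ t → column f (suc t))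

∑cells-+ : ∀ m (f g : Cell → ℕ) → ∑cells m (λ p → f p + g p) ≡ ∑cells m f + ∑cells m g
∑cells-+ m f g = trans (∑<-cong m regroup) (∑<-+ m (column f ∘ suc) (column g ∘ suc))
  where
  +-interchange₃ : ∀ a b c d e f → (a + b) + ((c + d) + (e + f)) ≡ (a + (c + e)) + (b + (d + f))
  +-interchange₃ = solve-∀
  regroup : ∀ t → column (λ p → f p + g p) (suc t) ≡ column f (suc t) + column g (suc t)
  regroup t = +-interchange₃ (f (zero , suc t)) (g (zero , suc t))
                             (f (suc zero , suc t)) (g (suc zero , suc t))
                             (f (suc (suc zero) , suc t)) (g (suc (suc zero) , suc t))

∑cells-cell : (v : Vertex 3 m) → ∑cells m (λ p → ⟦ does (p ≟ᶜ cell v) ⟧) ≡ 1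
∑cells-cell {m} (r , j) = trans (∑<-cong m (on-column r)) (∑<-indicator (toℕ<n j))
  where
  on-column : ∀ r t → column (λ p → ⟦ does (p ≟ᶜ cell (r , j)) ⟧) (suc t) ≡ ⟦ does (t ≟ toℕ j) ⟧
  on-column zero             t = +-identityʳ _
  on-column (suc zero)       t = +-identityʳ _
  on-column (suc (suc zero)) t = refl

∑cells-unique : {vs : List (Vertex 3 m)} → Unique vs →
                ∑cells m (λ p → ⟦ does (p ∈? map cell vs) ⟧) ≡ length vs
∑cells-unique {m} {[]}     []             = ∑<-zero m
∑cells-unique {m} {v ∷ vs} u@(_ ∷ unique) = begin
  ∑cells m (λ p → ⟦ does (p ∈? map cell (v ∷ vs)) ⟧)
    ≡⟨ ∑<-cong m (λ t → cong₂ _+_ (split (zero , suc t))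
                        (cong₂ _+_ (split (suc zero , suc t)) (split (suc (suc zero) , suc t)))) ⟩
  ∑cells m (λ p → ⟦ does (p ≟ᶜ cell v) ⟧ + ⟦ does (p ∈? map cell vs) ⟧)
    ≡⟨ ∑cells-+ m (λ p → ⟦ does (p ≟ᶜ cell v) ⟧) (λ p → ⟦ does (p ∈? map cell vs) ⟧) ⟩
  ∑cells m (λ p → ⟦ does (p ≟ᶜ cell v) ⟧) + ∑cells m (λ p → ⟦ does (p ∈? map cell vs) ⟧)
    ≡⟨ cong₂ _+_ (∑cells-cell v) (∑cells-unique unique) ⟩
  suc (length vs) ∎
  where
  open ≡-Reasoning
  split : ∀ p → ⟦ does (p ∈? map cell (v ∷ vs)) ⟧
              ≡ ⟦ does (p ≟ᶜ cell v) ⟧ + ⟦ does (p ∈? map cell vs) ⟧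
  split p with p ≟ᶜ cell v | p ∈? map cell vs
  ... | no _     | _         = refl
  ... | yes _    | no _      = refl
  ... | yes refl | yes p∈vs with ∈-map⁻ cell p∈vs
  ...   | w , w∈vs , v≡w =
    ⊥-elim (Unique[x∷xs]⇒x∉xs u (subst (_∈ vs) (sym (cell-injective v≡w)) w∈vs))

Adjᶜ : Cell → Cell → Set
Adjᶜ (i , x) (k , y) = (i ≡ k × Next x y) ⊎ (x ≡ y × Next (toℕ i) (toℕ k))

Adj⇒Adjᶜ : {u v : Vertex 3 m} → Adj u v → Adjᶜ (cell u) (cell v)
Adj⇒Adjᶜ (inj₁ (i≡k , d)) = inj₁ (i≡k , Sum.map (cong suc) (cong suc) d)
Adj⇒Adjᶜ (inj₂ (j≡l , d)) = inj₂ (cong (suc ∘ toℕ) j≡l , d)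

Adjᶜ⇒Adj : {u v : Vertex 3 m} → Adjᶜ (cell u) (cell v) → Adj u v
Adjᶜ⇒Adj (inj₁ (i≡k , d)) = inj₁ (i≡k , Sum.map suc-injective suc-injective d)
Adjᶜ⇒Adj (inj₂ (e , d))   = inj₂ (toℕ-injective (suc-injective e) , d)

rowNeighbours : Fin 3 → List (Fin 3)
rowNeighbours zero             = suc zero ∷ []
rowNeighbours (suc zero)       = zero ∷ suc (suc zero) ∷ []
rowNeighbours (suc (suc zero)) = suc zero ∷ []

∈-rowNeighbours : ∀ i k → Next (toℕ i) (toℕ k) → k ∈ rowNeighbours i
∈-rowNeighbours zero             (suc zero)       _ = here refl
∈-rowNeighbours (suc zero)       zero             _ = here refl
∈-rowNeighbours (suc zero)       (suc (suc zero)) _ = there (here refl)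
∈-rowNeighbours (suc (suc zero)) (suc zero)       _ = here refl
∈-rowNeighbours zero             zero             d = ⊥-elim (Next-irrefl d)
∈-rowNeighbours (suc zero)       (suc zero)       d = ⊥-elim (Next-irrefl d)
∈-rowNeighbours (suc (suc zero)) (suc (suc zero)) d = ⊥-elim (Next-irrefl d)
∈-rowNeighbours zero             (suc (suc zero)) (inj₁ ())
∈-rowNeighbours zero             (suc (suc zero)) (inj₂ ())
∈-rowNeighbours (suc (suc zero)) zero             (inj₁ ())
∈-rowNeighbours (suc (suc zero)) zero             (inj₂ ())

rowNeighbours-Next : ∀ i {k} → k ∈ rowNeighbours i → Next (toℕ i) (toℕ k)
rowNeighbours-Next zero             (here refl)         = inj₁ refl
rowNeighbours-Next (suc zero)       (here refl)         = inj₂ refl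
rowNeighbours-Next (suc zero)       (there (here refl)) = inj₁ refl
rowNeighbours-Next (suc (suc zero)) (here refl)         = inj₂ refl

neighbours : Fin 3 → ℕ → List Cell
neighbours i t = (i , t) ∷ (i , suc (suc t)) ∷ map (_, suc t) (rowNeighbours i)

Adjᶜ⇒∈neighbours : ∀ {i t q} → Adjᶜ (i , suc t) q → q ∈ neighbours i t
Adjᶜ⇒∈neighbours     (inj₁ (refl , inj₁ refl)) = there (here refl)
Adjᶜ⇒∈neighbours     (inj₁ (refl , inj₂ refl)) = here refl
Adjᶜ⇒∈neighbours {i} (inj₂ (refl , d))         = there (there (∈-map⁺ (_, _) (∈-rowNeighbours i _ d)))

∈neighbours⇒Adjᶜ : ∀ {i t q} → q ∈ neighbours i t → Adjᶜ (i , suc t) q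
∈neighbours⇒Adjᶜ     (here refl)         = inj₁ (refl , inj₂ refl)
∈neighbours⇒Adjᶜ     (there (here refl)) = inj₁ (refl , inj₁ refl)
∈neighbours⇒Adjᶜ {i} (there (there q∈)) with ∈-map⁻ (_, _) q∈
... | k , k∈ , refl = inj₂ (refl , rowNeighbours-Next i k∈)

neighbours-unique : ∀ i t → Unique (neighbours i t)
neighbours-unique zero             t = ((λ ()) ∷ (λ ()) ∷ []) ∷ ((λ ()) ∷ []) ∷ [] ∷ []
neighbours-unique (suc zero)       t =
  ((λ ()) ∷ (λ ()) ∷ (λ ()) ∷ []) ∷ ((λ ()) ∷ (λ ()) ∷ []) ∷ ((λ ()) ∷ []) ∷ [] ∷ []
neighbours-unique (suc (suc zero)) t = ((λ ()) ∷ (λ ()) ∷ []) ∷ ((λ ()) ∷ []) ∷ [] ∷ []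

Col : Set
Col = Bool × Bool × Bool

empty vertical : Col
empty    = false , false , false
vertical = true  , true  , false

weight : Col → ℕ
weight (b₀ , b₁ , b₂) = ⟦ b₀ ⟧ + (⟦ b₁ ⟧ + ⟦ b₂ ⟧)

_⇒ᵇ_ : Bool → Bool → Bool
b ⇒ᵇ c = not b ∨ c

locallyMatched : Col → Col → Col → Bool
locallyMatched (a₀ , a₁ , a₂) (b₀ , b₁ , b₂) (c₀ , c₁ , c₂) =
  (b₀ ⇒ᵇ exactlyOne (a₀ ∷ c₀ ∷ b₁ ∷ [])) ∧
  (b₁ ⇒ᵇ exactlyOne (a₁ ∷ c₁ ∷ b₀ ∷ b₂ ∷ [])) ∧
  (b₂ ⇒ᵇ exactlyOne (a₂ ∷ c₂ ∷ b₁ ∷ []))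

module Columns (M : InducedMatching 3 m) where

  sat : Cell → Bool
  sat p = does (p ∈? map cell (endpoints (edges M)))

  col : ℕ → Col
  col t = sat (zero , t) , sat (suc zero , t) , sat (suc (suc zero) , t)

  sat-cell : ∀ {v} → Saturated M v → sat (cell v) ≡ true
  sat-cell v∈ = dec-true (_ ∈? _) (∈-map⁺ cell v∈)

  sat⇒saturated : ∀ p → sat p ≡ true → ∃ λ v → p ≡ cell v × Saturated M v
  sat⇒saturated p s with p ∈? map cell (endpoints (edges M))
  ... | yes p∈ with ∈-map⁻ cell p∈
  ...   | v , v∈ , p≡ = v , p≡ , v∈

  ∑<-weight-col : ∑< m (weight ∘ col ∘ suc) ≡ 2 * size M
  ∑<-weight-col = trans (∑cells-unique (endpoints-edges-unique M)) (length-endpoints (edges M))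

  exactlyOne-saturated-neighbour : ∀ i t → sat (i , suc t) ≡ true →
                                   exactlyOne (map sat (neighbours i t)) ≡ true
  exactlyOne-saturated-neighbour i t s with sat⇒saturated (i , suc t) s
  ... | (k , l) , e , u-sat with cong proj₁ e | suc-injective (cong proj₂ e)
  ...   | refl | refl with saturated⇒∈M M u-sat
  ...     | w , uw =
    exactlyOne-map sat (neighbours-unique k (toℕ l)) (Adjᶜ⇒∈neighbours (Adj⇒Adjᶜ (∈M⇒Adj M uw)))
                   (sat-cell (∈M⇒saturated M (∈M-sym M uw))) only
    where
    only : ∀ {q} → q ∈ neighbours k (toℕ l) → sat q ≡ true → q ≡ cell w
    only q∈ sq with sat⇒saturated _ sq
    ... | v , refl , v-sat =
      cong cell (saturated-neighbour-is-partner M uw v-sat (Adjᶜ⇒Adj (∈neighbours⇒Adjᶜ q∈)))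

  locallyMatched-col : ∀ t → locallyMatched (col t) (col (suc t)) (col (suc (suc t))) ≡ true
  locallyMatched-col t = cong₂ _∧_ (row zero) (cong₂ _∧_ (row (suc zero)) (row (suc (suc zero))))
    where
    row : ∀ i → sat (i , suc t) ⇒ᵇ exactlyOne (map sat (neighbours i t)) ≡ true
    row i with sat (i , suc t) in s
    ... | false = refl
    ... | true  = exactlyOne-saturated-neighbour i t s

  col-zero : col 0 ≡ empty
  col-zero = cong₂ _,_ (unsaturated zero) (cong₂ _,_ (unsaturated (suc zero)) (unsaturated (suc (suc zero))))
    where
    unsaturated : ∀ i → sat (i , 0) ≡ false
    unsaturated i = dec-false ((i , 0) ∈? map cell (endpoints (edges M)))
                              λ p∈ → case ∈-map⁻ cell p∈ of λ where (_ , _ , ())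

  col-vertical : ∀ {j} → ((zero , j) , (suc zero , j)) ∈M M → col (suc (toℕ j)) ≡ vertical
  col-vertical {j} uw =
    cong₂ _,_ (sat-cell (∈M⇒saturated M uw)) (cong₂ _,_ (sat-cell (∈M⇒saturated M (∈M-sym M uw))) third)
    where
    third : sat (suc (suc zero) , suc (toℕ j)) ≡ false
    third with sat (suc (suc zero) , suc (toℕ j)) in s
    ... | false = refl
    ... | true with sat⇒saturated _ s
    ...   | v , e , v-sat with cell-injective {u = suc (suc zero) , j} e
    ...     | refl with saturated-neighbour-is-partner M (∈M-sym M uw) v-sat (inj₂ (refl , inj₁ refl))
    ...       | ()

-- * Potentials

∀Bool? : {P : Bool → Set} → (∀ b → Dec (P b)) → Dec (∀ b → P b)
∀Bool? P? = map′ (λ (f , t) → λ { false → f ; true → t }) (λ h → h false , h true)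
                 (P? false ×-dec P? true)

∀Col? : {P : Col → Set} → (∀ c → Dec (P c)) → Dec (∀ c → P c)
∀Col? P? = map′ (λ h (x , y , z) → h x y z) (λ h x y z → h (x , y , z))
                (∀Bool? λ x → ∀Bool? λ y → ∀Bool? λ z → P? (x , y , z))

-- Summed over all columns (∑<-telescope): 4|M| ≤ 3m + (first potential) − (last potential).
Step : (Col → Col → ℕ) → (Col → Col → ℕ) → Col → Col → Col → Set
Step P Q a b c = locallyMatched a b c ≡ true → 2 * weight b + Q b c ≤ 3 + P a b

step? : ∀ P Q a b c → Dec (Step P Q a b c)
step? P Q a b c = (locallyMatched a b c ≟ᵇ true) →-dec (2 * weight b + Q b c ≤? 3 + P a b)

-- ψ and φ are the shortest-path solution of the difference constraints ψ-step, φ-step,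
-- ψφ-step, ψ-empty and φ-≥3 below.
ψ : Col → Col → ℕ
ψ (false , true  , false) (_     , true  , _    ) = 1
ψ (false , true  , true ) (_     , false , false) = 1
ψ (true  , true  , false) (false , false , _    ) = 1
ψ (true  , false , true ) (false , _     , false) = 0
ψ (true  , false , true ) _                       = 1
ψ (_     , true  , true ) _                       = 5
ψ (true  , true  , _    ) _                       = 5
ψ _                       _                       = 2

φ : Col → Col → ℕ
φ (false , false , false) (true  , true  , false) = 4
φ (false , false , false) _                       = 5
φ (false , true  , false) (_     , true  , _    ) = 4
φ (false , true  , false) _                       = 5
φ (false , true  , true ) (_     , false , false) = 3
φ (true  , true  , false) (false , false , _    ) = 3
φ (true  , false , true ) (true  , _     , true ) = 4
φ (true  , false , true ) _                       = 3
φ (false , false , true ) _                       = 4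
φ (true  , false , false) _                       = 4
φ _                       _                       = 5

ψ-step : ∀ a b c → Step ψ ψ a b c
ψ-step = from-yes (∀Col? λ a → ∀Col? λ b → ∀Col? λ c → step? ψ ψ a b c)

φ-step : ∀ a b c → Step φ φ a b c
φ-step = from-yes (∀Col? λ a → ∀Col? λ b → ∀Col? λ c → step? φ φ a b c)

ψφ-step : ∀ b → Step ψ φ vertical b vertical
ψφ-step = from-yes (∀Col? λ b → step? ψ φ vertical b vertical)

ψφ-step-at : ∀ {a b c} → a ≡ vertical → c ≡ vertical → Step ψ φ a b c
ψφ-step-at refl refl = ψφ-step _

ψ-empty : ∀ b → ψ empty b ≤ 2
ψ-empty = from-yes (∀Col? λ b → ψ empty b ≤? 2)

φ-≥3 : ∀ a b → 3 ≤ φ a b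
φ-≥3 = from-yes (∀Col? λ a → ∀Col? λ b → 3 ≤? φ a b)

module _ (M : InducedMatching 3 m) {j j′ : Fin m} (j′≡j+2 : toℕ j′ ≡ toℕ j + 2)
         (vj : ((zero , j) , (suc zero , j)) ∈M M) (vj′ : ((zero , j′) , (suc zero , j′)) ∈M M) where

  open Columns M

  private
    s : ℕ
    s = suc (toℕ j)

    s<m : s < m
    s<m = ≤-trans (n≤1+n _) (subst (λ k → suc k ≤ m) (trans j′≡j+2 (+-comm (toℕ j) 2)) (toℕ<n j′))

    col-s+2 : col (suc (suc s)) ≡ vertical
    col-s+2 = trans (cong (col ∘ suc) (trans (+-comm 2 (toℕ j)) (sym j′≡j+2))) (col-vertical vj′)

    potential : ℕ → ℕ
    potential t = (if does (t ≤? s) then ψ else φ) (col t) (col (suc t))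

    potential-step : ∀ t → 2 * weight (col (suc t)) + potential (suc t) ≤ 3 + potential t
    potential-step t with <-cmp t s
    ... | tri< t<s _ _
      rewrite dec-true (t ≤? s) (<⇒≤ t<s) | dec-true (suc t ≤? s) t<s =
        ψ-step _ _ _ (locallyMatched-col t)
    ... | tri≈ _ refl _
      rewrite dec-true (t ≤? t) ≤-refl | dec-false (suc t ≤? t) (n≮n t) =
        ψφ-step-at (col-vertical vj) col-s+2 (locallyMatched-col t)
    ... | tri> _ _ s<t
      rewrite dec-false (t ≤? s) (<⇒≱ s<t) | dec-false (suc t ≤? s) (<⇒≱ (m<n⇒m<1+n s<t)) =
        φ-step _ _ _ (locallyMatched-col t)

    potential-start : potential 0 ≤ 2
    potential-start = subst (λ a → ψ a (col 1) ≤ 2) (sym col-zero) (ψ-empty (col 1))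

    potential-end : 3 ≤ potential m
    potential-end rewrite dec-false (m ≤? s) (<⇒≱ s<m) = φ-≥3 _ _

  two-vertical-edges-bound : 2 * (2 * size M) + 3 ≤ m * 3 + 2
  two-vertical-edges-bound = begin
    2 * (2 * size M) + 3                                  ≡⟨ cong (_+ 3) ∑<-2weight ⟨
    ∑< m (λ t → 2 * weight (col (suc t))) + 3           ≤⟨ +-monoʳ-≤ _ potential-end ⟩
    ∑< m (λ t → 2 * weight (col (suc t))) + potential m ≤⟨ ∑<-telescope _ potential potential-step m ⟩
    m * 3 + potential 0                                   ≤⟨ +-monoʳ-≤ (m * 3) potential-start ⟩
    m * 3 + 2                                             ∎
    where
    open ≤-Reasoning
    ∑<-2weight : ∑< m (λ t → 2 * weight (col (suc t))) ≡ 2 * (2 * size M)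
    ∑<-2weight = trans (∑<-*ˡ m 2 (weight ∘ col ∘ suc)) (cong (2 *_) ∑<-weight-col)

-- * A large induced matching

width : ℕ → ℕ
width k = 5 + k * 4

shift⁴ᵛ : Vertex n m → Vertex n (4 + m)
shift⁴ᵛ = shiftᵛ ∘ shiftᵛ ∘ shiftᵛ ∘ shiftᵛ

shift⁴ : Edge n m → Edge n (4 + m)
shift⁴ = shiftᵉ ∘ shiftᵉ ∘ shiftᵉ ∘ shiftᵉ

Adj-shift⁴ : {x y : Vertex n m} → Adj x y → Adj (shift⁴ᵛ x) (shift⁴ᵛ y)
Adj-shift⁴ = Adj-shift ∘ Adj-shift ∘ Adj-shift ∘ Adj-shift

Separated-shift⁴ : {e f : Edge n m} → Separated e f → Separated (shift⁴ e) (shift⁴ f)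
Separated-shift⁴ = Separated-shift ∘ Separated-shift ∘ Separated-shift ∘ Separated-shift

v₁₀ : Vertex 3 (suc m)
v₁₀ = suc zero , zero

block : List (Edge 3 (4 + m))
block = ((zero , zero) , (zero , suc zero))
      ∷ ((suc (suc zero) , zero) , (suc (suc zero) , suc zero))
      ∷ ((suc zero , suc (suc zero)) , (suc zero , suc (suc (suc zero))))
      ∷ []

construction : ∀ k → List (Edge 3 (width k))
construction zero    = ((zero , zero) , (zero , suc zero))
                     ∷ ((suc (suc zero) , zero) , (suc (suc zero) , suc zero))
                     ∷ ((zero , suc (suc (suc zero))) , (zero , suc (suc (suc (suc zero)))))
                     ∷ ((suc (suc zero) , suc (suc (suc zero))) , (suc (suc zero) , suc (suc (suc (suc zero)))))
                     ∷ []
construction (suc k) = block ++ map shift⁴ (construction k)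

length-construction : ∀ k → length (construction k) ≡ 4 + k * 3
length-construction zero    = refl
length-construction (suc k) =
  cong (3 +_) (trans (length-map shift⁴ (construction k)) (length-construction k))

construction-edges : ∀ k → All IsEdge (construction k)
construction-edges zero    = from-yes (All.all? (λ (a , b) → adj? a b) (construction zero))
construction-edges (suc k) =
  Allₚ.++⁺ (from-yes (All.all? (λ (a , b) → adj? a b) block))
           (Allₚ.map⁺ (All.map Adj-shift⁴ (construction-edges k)))

-- The row-1 edge of a block ends in column 3, next to v₁₀ of the shifted rest.
construction-avoids-v₁₀ : ∀ k → All (¬_ ∘ Endpoint v₁₀) (construction k)
construction-avoids-v₁₀ zero    = from-yes (All.all? (¬? ∘ endpoint? v₁₀) (construction zero))
construction-avoids-v₁₀ (suc k) =
  Allₚ.++⁺ (from-yes (All.all? (¬? ∘ endpoint? v₁₀) block))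
           (Allₚ.map⁺ (All.universal (λ _ → λ { (inj₁ ()) ; (inj₂ ()) }) _))

block-apart : ∀ {x} → x ∈ endpoints (block {suc m}) → (y : Vertex 3 (suc m)) → ¬ y ≡ v₁₀ →
              Apart x (shift⁴ᵛ y)
block-apart x∈ (r , suc c) _ =
  apart-far (s≤s (s≤s (≤-trans (All.lookup columns≤3 x∈) (m≤m+n 3 (toℕ c)))))
  where columns≤3 = from-yes (All.all? (λ x → toℕ (proj₂ x) ≤? 3) (endpoints block))
block-apart x∈ (zero , zero) _ =
  All.lookup (from-yes (All.all? (λ x → apart? x (shift⁴ᵛ (zero , zero))) (endpoints block))) x∈
block-apart x∈ (suc (suc zero) , zero) _ =
  All.lookup (from-yes (All.all? (λ x → apart? x (shift⁴ᵛ (suc (suc zero) , zero))) (endpoints block))) x∈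
block-apart x∈ (suc zero , zero) y≢v₁₀ = ⊥-elim (y≢v₁₀ refl)

block-separated : ∀ {e} {f : Edge 3 (suc m)} → e ∈ block → ¬ Endpoint v₁₀ f → Separated e (shift⁴ f)
block-separated e∈ avoid _ _ x∈e (inj₁ refl) = block-apart (∈-endpoints⁺ e∈ x∈e) _ (avoid ∘ inj₁ ∘ sym)
block-separated e∈ avoid _ _ x∈e (inj₂ refl) = block-apart (∈-endpoints⁺ e∈ x∈e) _ (avoid ∘ inj₂ ∘ sym)

construction-separated : ∀ k → AllPairs Separated (construction k)
construction-separated zero    = from-yes (allPairs? separated? (construction zero))
construction-separated (suc k) =
  AllPairsₚ.++⁺ (from-yes (allPairs? separated? block))
                (AllPairsₚ.map⁺ (AllPairs.map Separated-shift⁴ (construction-separated k)))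
                (All.tabulate λ e∈ → Allₚ.map⁺ (All.map (block-separated e∈) (construction-avoids-v₁₀ k)))

large-matching : ∀ k → InducedMatching 3 (width k)
large-matching k = fromList (construction k) (construction-edges k) (construction-separated k)

≡width : ∀ {m} → m % 4 ≡ 1 → 5 ≤ m → ∃ λ k → m ≡ width k
≡width {m} m%4≡1 5≤m with m / 4 | m≡m%n+[m/n]*n m 4
... | zero  | m≡ = case subst (5 ≤_) (trans m≡ (trans (+-identityʳ _) m%4≡1)) 5≤m of λ { (s≤s ()) }
... | suc k | m≡ = k , trans m≡ (cong (_+ suc k * 4) m%4≡1)

lemma3p4 : (m : ℕ) → m % 4 ≡ 1 → 5 ≤ m → (M : InducedMatching 3 m) →
    (j j2 : Fin m) → toℕ j2 ≡ toℕ j + 2 →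
    ((zero , j) , (suc zero , j)) ∈M M →
    ((zero , j2) , (suc zero , j2)) ∈M M →
    ¬ IsMax 3 m (size M)
lemma3p4 m m%4≡1 5≤m M j j2 j2≡j+2 vj vj2 (_ , maximal) with ≡width m%4≡1 5≤m
... | k , refl = 1+n≰n (≤-trans (n≤1+n _) (begin
  2 + (width k * 3 + 2)        ≡⟨ arithmetic k ⟩
  2 * (2 * (4 + k * 3)) + 3    ≤⟨ +-monoˡ-≤ 3 (*-monoʳ-≤ 2 (*-monoʳ-≤ 2 large≤M)) ⟩
  2 * (2 * size M) + 3         ≤⟨ two-vertical-edges-bound M j2≡j+2 vj vj2 ⟩
  width k * 3 + 2              ∎))
  where
  open ≤-Reasoning
  large≤M : 4 + k * 3 ≤ size M
  large≤M = subst (_≤ size M) (length-construction k) (maximal (large-matching k))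
  arithmetic : ∀ k → 2 + ((5 + k * 4) * 3 + 2) ≡ 2 * (2 * (4 + k * 3)) + 3
  arithmetic = solve-∀
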